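{- Let $G$ be a simple connected graph that is $3$-$\gamma_t$-critical and has order $\Delta(G)+3$. For a vertex $v\in V(G)$, let $S_v$ be a $\gamma_t(G-v)$-set, i.e. a total dominating set of $G-v$ of cardinality $\gamma_t(G-v)$. Then $S_v\cap N(v)=\emptyset$ for every $v\in V(G)$.
   Context: All graphs are simple, connected and undirected. $N(v)=\{u: uv\in E(G)\}$ is the open neighborhood of $v$ and $\Delta(G)$ is the maximum degree. A set $S\subseteq V(G)$ is a total dominating set if every vertex of $G$ (including those in $S$) is adjacent to some vertex of $S$; $\gamma_t(G)$ is the minimum cardinality of a total dominating set. A graph $G$ is $k$-$\gamma_t$-critical if $\gamma_t(G)=k$ and for every vertex $v$ of $G$ that is not adjacent to a vertex of degree one, $\gamma_t(G-v)=k-1$. -}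

module Defs where

open import Data.Nat using (ℕ; zero; suc; _≤_; _⊔_)
open import Data.Fin using (Fin)
open import Data.Fin.Subset using (Subset; _∈_; _⊆_; ∣_∣; ⊤; _-_)
open import Data.Bool using (Bool; true; false)
open import Data.Vec using (tabulate)
open import Data.List using (foldr; map; allFin)
open import Data.Product using (Σ; ∃; _×_)
open import Relation.Binary.PropositionalEquality using (_≡_)
open import Relation.Nullary using (¬_)

record Graph (n : ℕ) : Set where
  field
    adj    : Fin n → Fin n → Bool
    symm   : ∀ u v → adj u v ≡ adj v u
    loopless : ∀ v → adj v v ≡ false

module _ {n : ℕ} (G : Graph n) where
  open Graph G

  Adj : Fin n → Fin n → Set
  Adj u v = adj u v ≡ true

  N : Fin n → Subset n
  N v = tabulate (adj v)

  degree : Fin n → ℕ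
  degree v = ∣ N v ∣

  Δ : ℕ
  Δ = foldr _⊔_ 0 (map degree (allFin n))

  data Reach : Fin n → Fin n → Set where
    here : ∀ {u} → Reach u u
    step : ∀ {u v w} → Adj u v → Reach v w → Reach u w

  Connected : Set
  Connected = ∀ u v → Reach u v

  -- S is a total dominating set of the induced subgraph G[W]:
  -- S ⊆ W and every vertex of W is adjacent to some vertex of S.
  IsTDS : Subset n → Subset n → Set
  IsTDS W S = S ⊆ W × (∀ w → w ∈ W → ∃ λ u → u ∈ S × Adj w u)

  IsγtSet : Subset n → Subset n → Set
  IsγtSet W S = IsTDS W S × (∀ T → IsTDS W T → ∣ S ∣ ≤ ∣ T ∣)

  γt≡ : Subset n → ℕ → Set
  γt≡ W k = (∃ λ S → IsTDS W S × ∣ S ∣ ≡ k) × (∀ S → IsTDS W S → k ≤ ∣ S ∣)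

  minus : Fin n → Subset n
  minus v = ⊤ - v

  AdjToLeaf : Fin n → Set
  AdjToLeaf v = ∃ λ u → Adj v u × degree u ≡ 1

  Critical : ℕ → Set
  Critical k = γt≡ ⊤ k
             × (∀ v → ¬ AdjToLeaf v → ∀ j → suc j ≡ k → γt≡ (minus v) j)

-- If a γ_t(G-v)-set S contained a neighbour of v, then S would also dominate
-- v and hence be a total dominating set of G, so γ_t(G) ≤ |S| = γ_t(G-v).
-- That contradicts criticality, which applies at v: S totally dominates every
-- neighbour w of v by a vertex other than v, so w has degree at least 2 and v
-- is not adjacent to a leaf.
module Submission where

open import Defs
open import Data.Nat using (ℕ; suc; _+_; _≤_; s≤s; z≤n)
open import Data.Nat.Properties using (≤-trans; <⇒≱)
open import Data.Fin using (Fin; _≟_)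
open import Data.Fin.Subset using (Subset; _∈_; _∉_; _─_; _-_; ∣_∣; ⊤)
open import Data.Fin.Subset.Properties
  using (∈⊤; x∈⁅x⁆; x∈p∧x≢y⇒x∈p-y; x∈p⇒∣p-x∣<∣p∣)
open import Data.Vec using (_∷_; here; there)
open import Data.Vec.Properties using (lookup∘tabulate; []=⇒lookup; lookup⇒[]=)
open import Data.Product using (∃; _×_; _,_)
open import Relation.Binary.PropositionalEquality
  using (_≡_; _≢_; refl; sym; trans; subst)
open import Relation.Nullary using (¬_; yes; no)

x∈q⇒x∉p─q : ∀ {n} {p q : Subset n} {x} → x ∈ q → x ∉ p ─ q
x∈q⇒x∉p─q {p = _ ∷ _} here        ()
x∈q⇒x∉p─q {p = _ ∷ _} (there x∈q) (there x∈p─q) = x∈q⇒x∉p─q x∈q x∈p─q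

x∈p-y⇒x≢y : ∀ {n} {p : Subset n} {x y} → x ∈ p - y → x ≢ y
x∈p-y⇒x≢y x∈p-x refl = x∈q⇒x∉p─q (x∈⁅x⁆ _) x∈p-x

x∈p⇒1≤∣p∣ : ∀ {n} {p : Subset n} {x} → x ∈ p → 1 ≤ ∣ p ∣
x∈p⇒1≤∣p∣ x∈p = ≤-trans (s≤s z≤n) (x∈p⇒∣p-x∣<∣p∣ x∈p)

x∈p∧y∈p∧x≢y⇒2≤∣p∣ : ∀ {n} {p : Subset n} {x y} →
                    x ∈ p → y ∈ p → x ≢ y → 2 ≤ ∣ p ∣
x∈p∧y∈p∧x≢y⇒2≤∣p∣ x∈p y∈p x≢y =
  ≤-trans (s≤s (x∈p⇒1≤∣p∣ (x∈p∧x≢y⇒x∈p-y y∈p (λ y≡x → x≢y (sym y≡x)))))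
          (x∈p⇒∣p-x∣<∣p∣ x∈p)

module _ {n : ℕ} (G : Graph n) where
  open Graph G

  Adj-sym : ∀ {u v} → Adj G u v → Adj G v u
  Adj-sym {u} {v} uv = trans (symm v u) uv

  Adj⇒≢ : ∀ {u v} → Adj G u v → u ≢ v
  Adj⇒≢ {u} uu refl with trans (sym uu) (loopless u)
  ... | ()

  Adj⇒∈N : ∀ {v u} → Adj G v u → u ∈ N G v
  Adj⇒∈N {v} {u} vu = lookup⇒[]= u (N G v) (trans (lookup∘tabulate (adj v) u) vu)

  ∈N⇒Adj : ∀ {v u} → u ∈ N G v → Adj G v u
  ∈N⇒Adj {v} {u} u∈Nv = trans (sym (lookup∘tabulate (adj v) u)) ([]=⇒lookup u∈Nv)

  ≢⇒∈minus : ∀ {u v} → u ≢ v → u ∈ minus G v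
  ≢⇒∈minus u≢v = x∈p∧x≢y⇒x∈p-y ∈⊤ u≢v

  2≤degree : ∀ {w x y} → Adj G w x → Adj G w y → x ≢ y → 2 ≤ degree G w
  2≤degree wx wy x≢y = x∈p∧y∈p∧x≢y⇒2≤∣p∣ (Adj⇒∈N wx) (Adj⇒∈N wy) x≢y

  IsTDS-minus⇒¬AdjToLeaf : ∀ {v S} → IsTDS G (minus G v) S → ¬ AdjToLeaf G v
  IsTDS-minus⇒¬AdjToLeaf (S⊆G-v , dom) (w , vw , degw≡1)
    with dom w (≢⇒∈minus (λ w≡v → Adj⇒≢ vw (sym w≡v)))
  ... | x , x∈S , wx =
    <⇒≱ (s≤s (s≤s z≤n))
        (subst (2 ≤_) degw≡1 (2≤degree wx (Adj-sym vw) (x∈p-y⇒x≢y (S⊆G-v x∈S))))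

  IsTDS-minus⇒IsTDS : ∀ {v S u} → IsTDS G (minus G v) S → u ∈ S → Adj G v u →
                      IsTDS G ⊤ S
  IsTDS-minus⇒IsTDS {v} {S} {u} (_ , dom) u∈S vu = (λ _ → ∈⊤) , dominate
    where
    dominate : ∀ w → w ∈ ⊤ → ∃ λ x → x ∈ S × Adj G w x
    dominate w _ with w ≟ v
    ... | yes refl = u , u∈S , vu
    ... | no w≢v   = dom w (≢⇒∈minus w≢v)

  γtSet-minus-size : ∀ {k v S} → Critical G (suc k) → IsγtSet G (minus G v) S →
                     ∣ S ∣ ≤ k
  γtSet-minus-size {k} {v} {S} (_ , critical) (S-tds , S-min)
    with critical v (IsTDS-minus⇒¬AdjToLeaf S-tds) k refl
  ... | (T , T-tds , ∣T∣≡k) , _ = subst (∣ S ∣ ≤_) ∣T∣≡k (S-min T T-tds)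

  γtSet-minus-disjoint-N : ∀ {k v S} → Critical G (suc k) →
                           IsγtSet G (minus G v) S → ∀ u → u ∈ S → u ∉ N G v
  γtSet-minus-disjoint-N {S = S} crit@((_ , γt≥) , _) S-γt@(S-tds , _) u u∈S u∈Nv =
    <⇒≱ (s≤s (γtSet-minus-size crit S-γt))
        (γt≥ S (IsTDS-minus⇒IsTDS S-tds u∈S (∈N⇒Adj u∈Nv)))

lemma2p1 : (n : ℕ) (G : Graph n) → Connected G → Critical G 3
         → n ≡ Δ G + 3
         → (v : Fin n) (S : Subset n) → IsγtSet G (minus G v) S
         → ∀ u → u ∈ S → ¬ (u ∈ N G v)
lemma2p1 _ G _ crit _ _ _ S-γt = γtSet-minus-disjoint-N G crit S-γt
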